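{- Let $G$ and $H$ be nontrivial connected graphs of order $n$ and $n'$ respectively, and let $U_1,\dots,U_t$ be the true twin equivalence classes of $G$. Then $$\dim_2(G\boxtimes H)\ge n'\sum_{i=1}^t|U_i|.$$ Moreover, if every vertex of $G$ is a true twin, then $\dim_2(G\boxtimes H)=nn'$.
   Context: Graphs are finite, simple, connected; $d$ is the shortest-path distance. A set $S$ of vertices is a $2$-metric generator if every pair of distinct vertices $u,v$ has at least $2$ elements $w\in S$ with $d(u,w)\ne d(v,w)$; $\dim_2$ is the minimum cardinality of a $2$-metric generator. $N_G(x)$ and $N_G[x]=N_G(x)\cup\{x\}$ are the open and closed neighbourhoods. The twin equivalence relation on $V(G)$ is $x\,\mathcal{R}\,y$ iff $N_G[x]=N_G[y]$ or $N_G(x)=N_G(y)$. A true twin equivalence class is an equivalence class $U$ of $\mathcal{R}$ which is not a singleton and satisfies $N_G[x]=N_G[y]$ for all $x,y\in U$. A vertex $x$ is a true twin if there is $y\ne x$ with $N_G[x]=N_G[y]$. The strong product $G\boxtimes H$ has vertex set $V(G)\times V(H)$, with distinct $(x_1,x_2),(y_1,y_2)$ adjacent iff ($x_1=y_1$ and $x_2\sim y_2$) or ($x_1\sim y_1$ and $x_2=y_2$) or ($x_1\sim y_1$ and $x_2\sim y_2$). -}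

module Defs where

open import Data.Nat using (ℕ; zero; suc; _≤_; _*_)
open import Data.Bool using (Bool; true; false; _∧_; _∨_)
open import Data.Bool.Properties using (∧-comm)
open import Data.Fin using (Fin; remQuot; _≟_)
open import Data.Fin.Subset using (Subset; _∈_; ∣_∣)
open import Data.Product using (Σ; _×_; _,_; ∃; ∃-syntax; proj₁; proj₂)
open import Data.Sum using (_⊎_)
open import Function.Bundles using (_⇔_)
open import Relation.Nullary using (¬_; yes; no)
open import Relation.Nullary.Decidable using (⌊_⌋)
open import Relation.Binary.PropositionalEquality using (_≡_; _≢_; refl; sym; cong₂)

record Graph (n : ℕ) : Set where
  field
    adj    : Fin n → Fin n → Bool
    adj-sym : ∀ x y → adj x y ≡ adj y x
    irrefl  : ∀ x → adj x x ≡ false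

module _ {n : ℕ} (G : Graph n) where
  open Graph G

  _∼_ : Fin n → Fin n → Set
  x ∼ y = adj x y ≡ true

  data Walk : Fin n → Fin n → ℕ → Set where
    here : ∀ {u} → Walk u u 0
    step : ∀ {u w v k} → u ∼ w → Walk w v k → Walk u v (suc k)

  Connected : Set
  Connected = ∀ u v → ∃[ k ] Walk u v k

  Dist : Fin n → Fin n → ℕ → Set
  Dist u v k = Walk u v k × (∀ m → Walk u v m → k ≤ m)

  Distinguishes : Fin n → Fin n → Fin n → Set
  Distinguishes w u v = ∃[ a ] ∃[ b ] (Dist u w a × Dist v w b × a ≢ b)

  Is2MetricGenerator : Subset n → Set
  Is2MetricGenerator S = ∀ u v → u ≢ v →
    ∃[ w₁ ] ∃[ w₂ ] (w₁ ≢ w₂ × w₁ ∈ S × w₂ ∈ S ×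
                     Distinguishes w₁ u v × Distinguishes w₂ u v)

  IsDim2 : ℕ → Set
  IsDim2 k = (Σ (Subset n) λ S → Is2MetricGenerator S × ∣ S ∣ ≡ k)
           × (∀ S → Is2MetricGenerator S → k ≤ ∣ S ∣)

  InN : Fin n → Fin n → Set
  InN x z = x ∼ z

  InN[] : Fin n → Fin n → Set
  InN[] x z = z ≡ x ⊎ x ∼ z

  SameClosedNbhd : Fin n → Fin n → Set
  SameClosedNbhd x y = ∀ z → InN[] x z ⇔ InN[] y z

  SameOpenNbhd : Fin n → Fin n → Set
  SameOpenNbhd x y = ∀ z → InN x z ⇔ InN y z

  TwinRel : Fin n → Fin n → Set
  TwinRel x y = SameClosedNbhd x y ⊎ SameOpenNbhd x y

  InTrueTwinClass : Fin n → Set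
  InTrueTwinClass x =
    (∃[ y ] (y ≢ x × TwinRel x y)) ×
    (∀ y z → TwinRel x y → TwinRel x z → SameClosedNbhd y z)

  IsTrueTwin : Fin n → Set
  IsTrueTwin x = ∃[ y ] (y ≢ x × SameClosedNbhd x y)

eqb : ∀ {n} → Fin n → Fin n → Bool
eqb a b = ⌊ a ≟ b ⌋

eqb-sym : ∀ {n} (a b : Fin n) → eqb a b ≡ eqb b a
eqb-sym a b with a ≟ b | b ≟ a
... | yes _ | yes _ = refl
... | no _ | no _ = refl
... | yes p | no q with q (sym p)
... | ()
eqb-sym a b | no p | yes q with p (sym q)
... | ()

eqb-refl : ∀ {n} (a : Fin n) → eqb a a ≡ true
eqb-refl a with a ≟ a
... | yes _ = refl
... | no p with p refl
... | ()

-- strong product, vertex (a , b) encoded as an element of Fin (n * n')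
-- via remQuot / combine
strongAdj : ∀ {n n'} → Graph n → Graph n' → Fin n → Fin n' → Fin n → Fin n' → Bool
strongAdj G H a b c d =
  (eqb a c ∧ Graph.adj H b d) ∨ (Graph.adj G a c ∧ eqb b d) ∨ (Graph.adj G a c ∧ Graph.adj H b d)

fstV : ∀ {n} n' → Fin (n * n') → Fin n
fstV {n} n' i = proj₁ (remQuot {n} n' i)

sndV : ∀ {n} n' → Fin (n * n') → Fin n'
sndV {n} n' i = proj₂ (remQuot {n} n' i)

_⊠_ : ∀ {n n'} → Graph n → Graph n' → Graph (n * n')
_⊠_ {n} {n'} G H = record
  { adj = λ i j → strongAdj G H (fstV {n} n' i) (sndV {n} n' i)
                                 (fstV {n} n' j) (sndV {n} n' j)
  ; adj-sym = λ i j → symL (fstV {n} n' i) (sndV {n} n' i)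
                       (fstV {n} n' j) (sndV {n} n' j)
  ; irrefl = λ i → irrL (fstV {n} n' i) (sndV {n} n' i)
  }
  where
  symL : ∀ a b c d → strongAdj G H a b c d ≡ strongAdj G H c d a b
  symL a b c d rewrite eqb-sym a c | eqb-sym b d
                     | Graph.adj-sym G a c | Graph.adj-sym H b d = refl
  irrL : ∀ a b → strongAdj G H a b a b ≡ false
  irrL a b rewrite eqb-refl a | eqb-refl b
                 | Graph.irrefl G a | Graph.irrefl H b = refl

module Submission where

-- The whole argument rests on one observation: if u and v are true twins
-- (N[u] = N[v]), then no third vertex w distinguishes them, because any
-- shortest walk from u to w can be re-routed to start at v (and vice versa).
-- Since a 2-metric generator must distinguish u, v by two distinct vertices,
-- it contains u (and, symmetrically, v).
--
-- Every vertex of a true twin class is a true twin, so every 2-metric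
-- generator of G ⊠ H contains the fibres over the true twin classes, which
-- gives the lower bound; when all vertices are true twins the bound is n n',
-- attained by the whole vertex set.

open import Defs
open import Data.Nat using (ℕ; zero; suc; _+_; _*_; _≤_; _<_; z≤n; _≤?_)
open import Data.Nat.Properties
  using (≤-refl; ≤-trans; ≤-antisym; n≤1+n; n<1+n; ≰⇒>; m<1+n⇒m<n∨m≡n; m≤n+m; +-mono-≤; *-comm)
open import Data.Bool using (Bool; true; false; _∧_; _∨_)
import Data.Bool as Bool
open import Data.Bool.Properties using (∨-zeroʳ; ∨-assoc; ∧-distribˡ-∨; ∧-distribʳ-∨)
open import Data.Fin using (Fin; zero; suc; combine; remQuot; _↑ˡ_; _↑ʳ_; _≟_)
open import Data.Fin.Properties
  using (remQuot-combine; combine-remQuot; combine-injectiveˡ; combine-injectiveʳ; any?)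
open import Data.Fin.Subset using (Subset; _∈_; ∣_∣; ⊤; inside; outside)
open import Data.Fin.Subset.Properties using (∈⊤; ∣⊤∣≡n; p⊆q⇒∣p∣≤∣q∣)
open import Data.Vec using ([]; _∷_; _++_; splitAt)
open import Data.Vec.Base using (here; there)
open import Data.Product using (_×_; _,_; ∃; ∃-syntax; proj₁; proj₂; uncurry)
open import Data.Sum using (_⊎_; inj₁; inj₂)
open import Data.Empty using (⊥-elim)
open import Function.Bundles using (_⇔_; mk⇔; Equivalence)
open import Relation.Nullary using (¬_; Dec; yes; no)
open import Relation.Nullary.Decidable using (_×-dec_)
open import Relation.Binary.PropositionalEquality
  using (_≡_; _≢_; refl; sym; trans; cong; cong₂; subst; subst₂; module ≡-Reasoning)

bool-ext : ∀ {a b : Bool} → (a ≡ true → b ≡ true) → (b ≡ true → a ≡ true) → a ≡ b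
bool-ext {true}  {true}  _ _ = refl
bool-ext {true}  {false} f _ = sym (f refl)
bool-ext {false} {true}  _ g = g refl
bool-ext {false} {false} _ _ = refl

module Twins {N : ℕ} (K : Graph N) where

  sameClosed-refl : ∀ {u} → SameClosedNbhd K u u
  sameClosed-refl z = mk⇔ (λ h → h) (λ h → h)

  sameClosed-sym : ∀ {u v} → SameClosedNbhd K u v → SameClosedNbhd K v u
  sameClosed-sym sc z = mk⇔ (Equivalence.from (sc z)) (Equivalence.to (sc z))

  trueTwinClass⇒trueTwin : ∀ {x} → InTrueTwinClass K x → IsTrueTwin K x
  trueTwinClass⇒trueTwin ((y , y≢x , xRy) , closed) =
    y , y≢x , closed _ y (inj₁ sameClosed-refl) xRy

  -- Re-routing: a walk u ⇝ w (w ≠ u) of length a yields a walk v ⇝ w of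
  -- length ≤ a when N[u] = N[v]: the first step u ∼ u₁ becomes v ∼ u₁,
  -- or is dropped when u₁ = v.
  reroute : ∀ {u v w a} → SameClosedNbhd K u v → w ≢ u → Walk K u w a →
            ∃[ m ] (m ≤ a × Walk K v w m)
  reroute sc w≢u here = ⊥-elim (w≢u refl)
  reroute {a = suc a} sc w≢u (step {w = u₁} u∼u₁ rest)
    with Equivalence.to (sc u₁) (inj₂ u∼u₁)
  ... | inj₁ refl  = a , n≤1+n a , rest
  ... | inj₂ v∼u₁ = suc a , ≤-refl , step v∼u₁ rest

  twin-distinguisher : ∀ {u v w} → SameClosedNbhd K u v → Distinguishes K w u v →
                       w ≡ u ⊎ w ≡ v
  twin-distinguisher {u} {v} {w} sc (a , b , (pa , minA) , (pb , minB) , a≢b)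
    with w ≟ u | w ≟ v
  ... | yes w≡u | _       = inj₁ w≡u
  ... | no _    | yes w≡v = inj₂ w≡v
  ... | no w≢u  | no w≢v
    with reroute sc w≢u pa | reroute (sameClosed-sym sc) w≢v pb
  ... | m , m≤a , qv | m′ , m′≤b , qu =
    ⊥-elim (a≢b (≤-antisym (≤-trans (minA m′ qu) m′≤b) (≤-trans (minB m qv) m≤a)))

  twin-in-generator : ∀ {S u v} → Is2MetricGenerator K S → SameClosedNbhd K u v →
                      u ≢ v → u ∈ S
  twin-in-generator {u = u} {v} gen sc u≢v with gen u v u≢v
  ... | w₁ , w₂ , w₁≢w₂ , w₁∈S , w₂∈S , dist₁ , dist₂
    with twin-distinguisher sc dist₁ | twin-distinguisher sc dist₂
  ... | inj₁ refl | _         = w₁∈S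
  ... | inj₂ _    | inj₁ refl = w₂∈S
  ... | inj₂ refl | inj₂ refl = ⊥-elim (w₁≢w₂ refl)

module Distances {N : ℕ} (K : Graph N) where

  walk? : ∀ m u v → Dec (Walk K u v m)
  walk? zero u v with u ≟ v
  ... | yes refl = yes here
  ... | no u≢v   = no λ { here → u≢v refl }
  walk? (suc m) u v with any? (λ w → (Graph.adj K u w Bool.≟ true) ×-dec walk? m w v)
  ... | yes (w , u∼w , rest) = yes (step u∼w rest)
  ... | no none               = no λ { (step u∼w rest) → none (_ , u∼w , rest) }

  search-dist : ∀ u v B → (∀ m → m < B → ¬ Walk K u v m) ⊎ ∃ (Dist K u v)
  search-dist u v zero = inj₁ λ m ()
  search-dist u v (suc B) with search-dist u v B
  ... | inj₂ d = inj₂ d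
  ... | inj₁ none<B with walk? B u v
  ... | yes p = inj₂ (B , p , least)
    where
    least : ∀ m → Walk K u v m → B ≤ m
    least m q with B ≤? m
    ... | yes B≤m = B≤m
    ... | no B≰m  = ⊥-elim (none<B m (≰⇒> B≰m) q)
  ... | no ¬p = inj₁ λ m m<1+B → none≤B (m<1+n⇒m<n∨m≡n m<1+B)
    where
    none≤B : ∀ {m} → m < B ⊎ m ≡ B → ¬ Walk K u v m
    none≤B {m} (inj₁ m<B) = none<B m m<B
    none≤B (inj₂ refl)    = ¬p

  dist-exists : Connected K → ∀ u v → ∃ (Dist K u v)
  dist-exists conn u v with conn u v
  ... | k , p with search-dist u v (suc k)
  ... | inj₁ none = ⊥-elim (none k (n<1+n k) p)
  ... | inj₂ d    = d

  walk-zero : ∀ {u v} → Walk K u v 0 → u ≡ v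
  walk-zero here = refl

  dist-self : ∀ {u} → Dist K u u 0
  dist-self = here , λ _ _ → z≤n

  self-distinguishes : Connected K → ∀ {u v} → u ≢ v → Distinguishes K u u v
  self-distinguishes conn {u} {v} u≢v with dist-exists conn v u
  ... | b , dv = 0 , b , dist-self , dv ,
    λ 0≡b → u≢v (sym (walk-zero (subst (Walk K v u) (sym 0≡b) (proj₁ dv))))

  full-generator : Connected K → Is2MetricGenerator K ⊤
  full-generator conn u v u≢v =
    u , v , u≢v , ∈⊤ , ∈⊤ , self-distinguishes conn u≢v ,
    swap (self-distinguishes conn (λ e → u≢v (sym e)))
    where
    swap : ∀ {w x y} → Distinguishes K w x y → Distinguishes K w y x
    swap (a , b , da , db , a≢b) = b , a , db , da , λ e → a≢b (sym e)

  concat : ∀ {u w v k m} → Walk K u w k → Walk K w v m → Walk K u v (k + m)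
  concat here       q = q
  concat (step e p) q = step e (concat p q)

-- Closed neighbourhoods as Boolean functions, which makes them computable
-- in the strong product, whose adjacency is a Boolean formula.
module ClosedNeighbourhood {N : ℕ} (K : Graph N) where

  closedB : Fin N → Fin N → Bool
  closedB u z = eqb u z ∨ Graph.adj K u z

  closedB-complete : ∀ {u z} → InN[] K u z → closedB u z ≡ true
  closedB-complete {u} (inj₁ refl) rewrite eqb-refl u = refl
  closedB-complete {u} {z} (inj₂ u∼z) rewrite u∼z = ∨-zeroʳ (eqb u z)

  closedB-sound : ∀ u z → closedB u z ≡ true → InN[] K u z
  closedB-sound u z h with u ≟ z
  ... | yes u≡z = inj₁ (sym u≡z)
  ... | no _    = inj₂ h

  sameClosed⇒closedB : ∀ {u v} → SameClosedNbhd K u v → ∀ z → closedB u z ≡ closedB v z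
  sameClosed⇒closedB {u} {v} sc z = bool-ext
    (λ h → closedB-complete (Equivalence.to (sc z) (closedB-sound u z h)))
    (λ h → closedB-complete (Equivalence.from (sc z) (closedB-sound v z h)))

  closedB⇒sameClosed : ∀ {u v} → (∀ z → closedB u z ≡ closedB v z) → SameClosedNbhd K u v
  closedB⇒sameClosed {u} {v} eq z =
    mk⇔ (λ h → closedB-sound v z (trans (sym (eq z)) (closedB-complete h)))
        (λ h → closedB-sound u z (trans (eq z) (closedB-complete h)))

∣++∣ : ∀ {m k} (S₁ : Subset m) (S₂ : Subset k) → ∣ S₁ ++ S₂ ∣ ≡ ∣ S₁ ∣ + ∣ S₂ ∣
∣++∣ []             S₂ = refl
∣++∣ (inside ∷ S₁)  S₂ = cong suc (∣++∣ S₁ S₂)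
∣++∣ (outside ∷ S₁) S₂ = ∣++∣ S₁ S₂

∈-++⁻ˡ : ∀ {m k} {S₁ : Subset m} (S₂ : Subset k) {i} → (i ↑ˡ k) ∈ S₁ ++ S₂ → i ∈ S₁
∈-++⁻ˡ {S₁ = _ ∷ _} S₂ {zero}  here      = here
∈-++⁻ˡ {S₁ = _ ∷ _} S₂ {suc i} (there p) = there (∈-++⁻ˡ S₂ p)

∈-++⁻ʳ : ∀ {m k} (S₁ : Subset m) {S₂ : Subset k} {j} → (m ↑ʳ j) ∈ S₁ ++ S₂ → j ∈ S₂
∈-++⁻ʳ []       p         = p
∈-++⁻ʳ (_ ∷ S₁) (there p) = ∈-++⁻ʳ S₁ p

full-subset : ∀ {m} (S : Subset m) → (∀ i → i ∈ S) → m ≤ ∣ S ∣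
full-subset {m} S all = subst (_≤ ∣ S ∣) (∣⊤∣≡n m) (p⊆q⇒∣p∣≤∣q∣ {p = ⊤} (λ {i} _ → all i))

fibre-bound : ∀ {n'} n (T : Subset n) (S : Subset (n * n')) →
              (∀ x b → x ∈ T → combine x b ∈ S) → ∣ T ∣ * n' ≤ ∣ S ∣
fibre-bound zero [] S _ = z≤n
fibre-bound {n'} (suc n) (t ∷ T) S fibres with splitAt n' S
... | S₁ , S₂ , refl = subst (∣ t ∷ T ∣ * n' ≤_) (sym (∣++∣ S₁ S₂)) (bound t fibres)
  where
  -- S₁ is the part of S over the first vertex, S₂ the part over the others.
  rest : ∀ {t} → (∀ x b → x ∈ t ∷ T → combine x b ∈ S₁ ++ S₂) → ∣ T ∣ * n' ≤ ∣ S₂ ∣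
  rest fibres = fibre-bound n T S₂ (λ x b x∈T → ∈-++⁻ʳ S₁ (fibres (suc x) b (there x∈T)))

  bound : ∀ t → (∀ x b → x ∈ t ∷ T → combine x b ∈ S₁ ++ S₂) →
          ∣ t ∷ T ∣ * n' ≤ ∣ S₁ ∣ + ∣ S₂ ∣
  bound inside  fibres =
    +-mono-≤ (full-subset S₁ (λ b → ∈-++⁻ˡ S₂ (fibres zero b here))) (rest fibres)
  bound outside fibres = ≤-trans (rest fibres) (m≤n+m ∣ S₂ ∣ ∣ S₁ ∣)

module StrongProduct {n n'} (G : Graph n) (H : Graph n') where
  open Twins
  open Distances
  open ClosedNeighbourhood

  P : Graph (n * n')
  P = G ⊠ H

  adj-combine : ∀ x b c d →
    Graph.adj P (combine x b) (combine c d) ≡ strongAdj G H x b c d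
  adj-combine x b c d =
    cong₂ (λ p q → strongAdj G H (proj₁ p) (proj₂ p) (proj₁ q) (proj₂ q))
          (remQuot-combine {n} {n'} x b) (remQuot-combine {n} {n'} c d)

  eqb-combine : ∀ x b c d → eqb (combine {n} {n'} x b) (combine c d) ≡ eqb x c ∧ eqb b d
  eqb-combine x b c d with combine {n} {n'} x b ≟ combine c d | x ≟ c | b ≟ d
  ... | yes _ | yes _    | yes _   = refl
  ... | yes e | no x≢c   | _       = ⊥-elim (x≢c (combine-injectiveˡ x b c d e))
  ... | yes e | yes _    | no b≢d  = ⊥-elim (b≢d (combine-injectiveʳ x b c d e))
  ... | no ne | yes refl | yes refl = ⊥-elim (ne refl)
  ... | no _  | no _     | _       = refl
  ... | no _  | yes _    | no _    = refl

  closedB-combine : ∀ x b c d →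
    closedB P (combine x b) (combine c d) ≡ closedB G x c ∧ closedB H b d
  closedB-combine x b c d = begin
    closedB P (combine x b) (combine c d)
      ≡⟨ cong₂ _∨_ (eqb-combine x b c d) (adj-combine x b c d) ⟩
    (e ∧ e′) ∨ ((e ∧ h) ∨ (g ∧ e′) ∨ (g ∧ h))
      ≡⟨ sym (∨-assoc (e ∧ e′) (e ∧ h) ((g ∧ e′) ∨ (g ∧ h))) ⟩
    ((e ∧ e′) ∨ (e ∧ h)) ∨ ((g ∧ e′) ∨ (g ∧ h))
      ≡⟨ sym (cong₂ _∨_ (∧-distribˡ-∨ e e′ h) (∧-distribˡ-∨ g e′ h)) ⟩
    (e ∧ (e′ ∨ h)) ∨ (g ∧ (e′ ∨ h))
      ≡⟨ sym (∧-distribʳ-∨ (e′ ∨ h) e g) ⟩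
    (e ∨ g) ∧ (e′ ∨ h) ∎
    where
    open ≡-Reasoning
    e = eqb x c
    e′ = eqb b d
    g = Graph.adj G x c
    h = Graph.adj H b d

  twin-lift : ∀ {x y} b → SameClosedNbhd G x y →
              SameClosedNbhd P (combine x b) (combine y b)
  twin-lift {x} {y} b sc = closedB⇒sameClosed P λ z →
    subst (λ z → closedB P (combine x b) z ≡ closedB P (combine y b) z)
          (combine-remQuot {n} n' z) (same (remQuot {n} n' z))
    where
    open ≡-Reasoning
    same : ∀ cd → closedB P (combine x b) (uncurry combine cd)
                ≡ closedB P (combine y b) (uncurry combine cd)
    same (c , d) = begin
      closedB P (combine x b) (combine c d) ≡⟨ closedB-combine x b c d ⟩
      closedB G x c ∧ closedB H b d         ≡⟨ cong (_∧ closedB H b d) (sameClosed⇒closedB G sc c) ⟩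
      closedB G y c ∧ closedB H b d         ≡⟨ sym (closedB-combine y b c d) ⟩
      closedB P (combine y b) (combine c d) ∎

  fibre-in-generator : ∀ {S x} → Is2MetricGenerator P S → IsTrueTwin G x →
                       ∀ b → combine x b ∈ S
  fibre-in-generator gen (y , y≢x , sc) b =
    twin-in-generator P gen (twin-lift b sc)
      (λ e → y≢x (sym (combine-injectiveˡ _ b _ b e)))

  walk-in-G-layer : ∀ {x y k} b → Walk G x y k → Walk P (combine x b) (combine y b) k
  walk-in-G-layer b here = here
  walk-in-G-layer {x} b (step {w = c} x∼c p) = step adjacent (walk-in-G-layer b p)
    where
    adjacent : Graph.adj P (combine x b) (combine c b) ≡ true
    adjacent rewrite adj-combine x b c b | x∼c | eqb-refl b =
      ∨-zeroʳ (eqb x c ∧ Graph.adj H b b)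

  walk-in-H-layer : ∀ x {b d k} → Walk H b d k → Walk P (combine x b) (combine x d) k
  walk-in-H-layer x here = here
  walk-in-H-layer x {b} (step {w = d} b∼d p) = step adjacent (walk-in-H-layer x p)
    where
    adjacent : Graph.adj P (combine x b) (combine x d) ≡ true
    adjacent rewrite adj-combine x b x d | eqb-refl x | b∼d = refl

  product-connected : Connected G → Connected H → Connected P
  product-connected connG connH u v =
    subst₂ (λ u v → ∃ (Walk P u v))
      (combine-remQuot {n} n' u) (combine-remQuot {n} n' v)
      (connect (remQuot {n} n' u) (remQuot {n} n' v))
    where
    connect : ∀ xb yd → ∃ (Walk P (uncurry combine xb) (uncurry combine yd))
    connect (x , b) (y , d) with connG x y | connH b d
    ... | k , p | m , q = k + m , concat P (walk-in-G-layer b p) (walk-in-H-layer y q)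

theorem20 : ∀ {n n'} (G : Graph n) (H : Graph n') →
    2 ≤ n → 2 ≤ n' → Connected G → Connected H →
    ((T : Subset n) → (∀ x → (x ∈ T) ⇔ InTrueTwinClass G x) →
    ∀ k → IsDim2 (G ⊠ H) k → n' * ∣ T ∣ ≤ k)
    × ((∀ x → IsTrueTwin G x) → IsDim2 (G ⊠ H) (n * n'))
theorem20 {n} {n'} G H _ _ connG connH = lower-bound , all-twins
  where
  open StrongProduct G H

  lower-bound : (T : Subset n) → (∀ x → (x ∈ T) ⇔ InTrueTwinClass G x) →
                ∀ k → IsDim2 P k → n' * ∣ T ∣ ≤ k
  lower-bound T T-classes k ((S , gen , refl) , _) =
    subst (_≤ ∣ S ∣) (*-comm ∣ T ∣ n') (fibre-bound n T S λ x b x∈T →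
      fibre-in-generator gen
        (Twins.trueTwinClass⇒trueTwin G (Equivalence.to (T-classes x) x∈T)) b)

  all-twins : (∀ x → IsTrueTwin G x) → IsDim2 P (n * n')
  all-twins twin =
    (⊤ , Distances.full-generator P (product-connected connG connH) , ∣⊤∣≡n (n * n')) ,
    λ S gen → subst (λ m → m * n' ≤ ∣ S ∣) (∣⊤∣≡n n)
                (fibre-bound n ⊤ S λ x b _ → fibre-in-generator gen (twin x) b)
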